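{- If an $n$-element poset $P$ is a disjoint union of two or more non-empty chains, then $\mathcal{BK}_P\cong{\mathfrak{S}}_n$.
   Context: A linear extension of $P$ is a list $(p_1,\dots,p_n)$ of all elements with $p_a<_P p_b$ implying $a<b$; ${\mathcal{L}}(P)$ is the set of these. The Bender--Knuth move $t_i$ ($1\le i\le n-1$) acts on ${\mathcal{L}}(P)$ by swapping $p_i,p_{i+1}$ if incomparable and fixing the list otherwise; $\mathcal{BK}_P$ is the subgroup of the symmetric group on ${\mathcal{L}}(P)$ they generate. ${\mathfrak{S}}_n$ is the symmetric group on $n$ letters. -}

module Defs where

open import Level using (0ℓ)
open import Data.Nat as ℕ using (ℕ; suc; _≤_; _≟_)
open import Data.Nat.Properties using (≤-trans; n≤1+n)
open import Data.Fin as Fin using (Fin; toℕ; fromℕ<)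
open import Data.Fin.Permutation using (Permutation′; _⟨$⟩ʳ_)
open import Data.List using (List; []; _∷_; _++_)
open import Data.Product using (Σ; Σ-syntax; ∃; ∃-syntax; _×_; _,_)
open import Data.Sum using (_⊎_)
open import Function using (_∘_; id; _⇔_)
open import Relation.Nullary using (¬_; yes; no)
open import Relation.Binary using (Rel; Decidable; IsStrictPartialOrder)
open import Relation.Binary.PropositionalEquality using (_≡_; _≢_)

-- A finite poset on the n-element set Fin n, given by its strict order
-- (p <_P q), assumed decidable so that the Bender–Knuth moves are computable.
record FinPoset (n : ℕ) : Set₁ where
  field
    _<P_      : Rel (Fin n) 0ℓ
    isSPO     : IsStrictPartialOrder _≡_ _<P_
    _<P?_     : Decidable _<P_

record IsDisjointUnionOfChains {n : ℕ} (P : FinPoset n) : Set where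
  open FinPoset P
  field
    k          : ℕ
    two≤k      : 2 ≤ k
    block      : Fin n → Fin k
    nonempty   : ∀ (b : Fin k) → ∃[ x ] block x ≡ b
    comparable : ∀ (x y : Fin n) →
                 (x <P y ⊎ y <P x) ⇔ (block x ≡ block y × x ≢ y)

module _ {n : ℕ} (P : FinPoset n) where
  open FinPoset P

  -- A linear extension (p_1,…,p_n): position ↦ element, a list of all
  -- elements (each exactly once) with p_a <_P p_b ⇒ a < b.
  record LinExt : Set where
    field
      seq      : Fin n → Fin n
      covers   : ∀ x → ∃[ a ] seq a ≡ x
      distinct : ∀ a b → seq a ≡ seq b → a ≡ b
      order    : ∀ a b → seq a <P seq b → a Fin.< b

  -- Index of a Bender–Knuth move t_{i+1} (0-based i): swaps positions i, i+1.
  Gen : Set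
  Gen = Σ[ i ∈ ℕ ] suc i ℕ.< n

  swapPos : Gen → Fin n → Fin n
  swapPos (i , p) a with toℕ a ≟ i | toℕ a ≟ suc i
  ... | yes _ | _     = fromℕ< p
  ... | no _  | yes _ = fromℕ< (≤-trans (n≤1+n (suc i)) p)
  ... | no _  | no _  = a

  bk : Gen → (Fin n → Fin n) → (Fin n → Fin n)
  bk g@(i , p) s with s (fromℕ< (≤-trans (n≤1+n (suc i)) p)) <P? s (fromℕ< p)
                    | s (fromℕ< p) <P? s (fromℕ< (≤-trans (n≤1+n (suc i)) p))
  ... | yes _ | _     = s
  ... | no _  | yes _ = s
  ... | no _  | no _  = s ∘ swapPos g

  Word : Set
  Word = List Gen

  act : Word → (Fin n → Fin n) → (Fin n → Fin n)
  act []      = id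
  act (g ∷ w) = bk g ∘ act w

  -- Two words give the same element of BK_P ⊆ Sym(L(P)) iff they act
  -- identically on every linear extension.
  _≈BK_ : Word → Word → Set
  w ≈BK w' = ∀ (L : LinExt) (a : Fin n) →
             act w (LinExt.seq L) a ≡ act w' (LinExt.seq L) a

  -- BK_P ≅ 𝔖_n: a map from words to permutations of Fin n that is
  -- well-defined and injective on BK_P, multiplicative, and surjective.
  BK≅Sym : Set
  BK≅Sym =
    Σ[ f ∈ (Word → Permutation′ n) ]
      ((∀ w w' → (w ≈BK w') ⇔ (∀ x → f w ⟨$⟩ʳ x ≡ f w' ⟨$⟩ʳ x))
      × (∀ w w' x → f (w ++ w') ⟨$⟩ʳ x ≡ f w ⟨$⟩ʳ (f w' ⟨$⟩ʳ x))
      × (∀ (σ : Permutation′ n) → ∃[ w ] (∀ x → f w ⟨$⟩ʳ x ≡ σ ⟨$⟩ʳ x)))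

-- Record a linear extension by its word of chain labels, block ∘ seq. Within a chain the
-- order is forced, so a linear extension is determined by this word. A move t_i acts on it by
-- exchanging the letters in positions i and i+1: trivially if t_i swaps, and otherwise because
-- the two entries are comparable and hence carry the same label. So a word w in the moves acts
-- on label words through a product π_w of adjacent transpositions of positions, and w ↦ π_w is
-- a homomorphism onto 𝔖_n. It is injective on BK_P: with at least two chains, any two positions
-- can be given different labels by some linear extension, so words with different π_w act
-- differently on it.
module Submission where

open import Defs
open import Data.Nat using (ℕ)

open import Data.Nat as ℕ using (zero; suc)
import Data.Nat.Properties as ℕ
open import Data.Fin as Fin using (Fin; toℕ; fromℕ<)
open import Data.Fin.Properties using (toℕ-injective; toℕ-fromℕ<; any?; injective⇒≤; punchOut-injective)
import Data.Fin.Properties as FinP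
import Data.Fin.Induction as FinI
open import Data.Fin.Permutation using (Permutation′; _⟨$⟩ʳ_; _⟨$⟩ˡ_; _∘ₚ_; _≈_; flip; inverseˡ; inverseʳ)
import Data.Fin.Permutation as Perm
open import Data.Fin.Permutation.Components using (transpose)
open import Data.Fin.Permutation.Transposition.List using (TranspositionList; eval; decompose; eval-decompose)
open import Data.List using ([]; _∷_; _++_)
open import Data.Product using (_×_; _,_; ∃-syntax; Σ-syntax; proj₁; proj₂)
open import Data.Product.Relation.Binary.Lex.Strict using (×-Lex; ×-transitive; ×-decidable)
open import Data.Sum using (_⊎_; inj₁; inj₂)
open import Data.Unit using (tt)
open import Data.Empty using (⊥-elim)
open import Function using (_∘_; _on_; Equivalence; _⇔_; mk⇔)
open import Function.Definitions using (Injective)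
open import Induction.WellFounded using (module All)
open import Level using (0ℓ)
open import Relation.Nullary using (¬_; yes; no)
open import Relation.Nullary.Decidable using (dec-true; dec-false)
open import Relation.Unary using (Pred; _⊆_)
import Relation.Unary as U
open import Relation.Binary using (Rel; Decidable; Transitive; IsStrictPartialOrder; tri<; tri≈; tri>)
open import Relation.Binary.PropositionalEquality
open ≡-Reasoning

private
  variable
    m m′ : ℕ

transposeˡ : ∀ (i j : Fin m) → transpose i j i ≡ j
transposeˡ i j rewrite dec-true (i Fin.≟ i) refl = refl

transposeʳ : ∀ (i j : Fin m) → transpose i j j ≡ i
transposeʳ i j with j Fin.≟ i
... | yes j≡i = j≡i
... | no _ rewrite dec-true (j Fin.≟ j) refl = refl

transpose-fix : ∀ {i j k : Fin m} → k ≢ i → k ≢ j → transpose i j k ≡ k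
transpose-fix {i = i} {j} {k} k≢i k≢j
  rewrite dec-false (k Fin.≟ i) k≢i | dec-false (k Fin.≟ j) k≢j = refl

-- Case analysis on the argument of a transposition that, unlike a with-clause,
-- leaves the occurrences of transpose in Q unreduced.
transpose-cases : ∀ {a} (i j : Fin m) (Q : Fin m → Set a) →
                  Q i → Q j → (∀ k → k ≢ i → k ≢ j → Q k) → ∀ k → Q k
transpose-cases i j Q Qi Qj Qk k with k Fin.≟ i | k Fin.≟ j
... | yes refl | _        = Qi
... | no _     | yes refl = Qj
... | no k≢i   | no k≢j   = Qk k k≢i k≢j

transpose-conjugate : ∀ (f : Fin m → Fin m′) → Injective _≡_ _≡_ f →
                      ∀ i j k → f (transpose i j k) ≡ transpose (f i) (f j) (f k)
transpose-conjugate f f-inj i j = transpose-cases i j _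
  (trans (cong f (transposeˡ i j)) (sym (transposeˡ (f i) (f j))))
  (trans (cong f (transposeʳ i j)) (sym (transposeʳ (f i) (f j))))
  (λ k k≢i k≢j → trans (cong f (transpose-fix k≢i k≢j))
                   (sym (transpose-fix (k≢i ∘ f-inj) (k≢j ∘ f-inj))))

transpose-involutive : ∀ (i j k : Fin m) → transpose i j (transpose i j k) ≡ k
transpose-involutive i j = transpose-cases i j _
  (trans (cong (transpose i j) (transposeˡ i j)) (transposeʳ i j))
  (trans (cong (transpose i j) (transposeʳ i j)) (transposeˡ i j))
  (λ k k≢i k≢j → trans (cong (transpose i j) (transpose-fix k≢i k≢j)) (transpose-fix k≢i k≢j))

transpose-injective : ∀ (i j : Fin m) → Injective _≡_ _≡_ (transpose i j)
transpose-injective i j {k} {l} e =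
  trans (sym (transpose-involutive i j k)) (trans (cong (transpose i j) e) (transpose-involutive i j l))

transpose-invariant : ∀ {a} {A : Set a} (f : Fin m → A) {i j} → f i ≡ f j →
                      ∀ k → f (transpose i j k) ≡ f k
transpose-invariant f {i} {j} fi≡fj = transpose-cases i j _
  (trans (cong f (transposeˡ i j)) (sym fi≡fj))
  (trans (cong f (transposeʳ i j)) fi≡fj)
  (λ k k≢i k≢j → cong f (transpose-fix k≢i k≢j))

transpose-self : ∀ (i k : Fin m) → transpose i i k ≡ k
transpose-self i =
  transpose-cases i i _ (transposeˡ i i) (transposeʳ i i) (λ _ k≢i _ → transpose-fix k≢i k≢i)

transpose-comm : ∀ (i j k : Fin m) → transpose i j k ≡ transpose j i k
transpose-comm i j = transpose-cases i j _
  (trans (transposeˡ i j) (sym (transposeʳ j i)))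
  (trans (transposeʳ i j) (sym (transposeˡ j i)))
  (λ _ k≢i k≢j → trans (transpose-fix k≢i k≢j) (sym (transpose-fix k≢j k≢i)))

transpose-adjacent-< : ∀ {i j : Fin m} → toℕ j ≡ suc (toℕ i) →
                       ∀ k l → k Fin.< l → ¬ (k ≡ i × l ≡ j) → transpose i j k Fin.< transpose i j l
transpose-adjacent-< {i = i} {j} j≡1+i = transpose-cases i j _ from-i from-j from-other
  where
  i<j : i Fin.< j
  i<j = subst (toℕ i ℕ.<_) (sym j≡1+i) (ℕ.n<1+n (toℕ i))

  from-i : ∀ l → i Fin.< l → ¬ (i ≡ i × l ≡ j) → transpose i j i Fin.< transpose i j l
  from-i l i<l ¬ij rewrite transposeˡ i j
                         | transpose-fix (ℕ.<⇒≢ i<l ∘ cong toℕ ∘ sym) (¬ij ∘ (refl ,_)) =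
    ℕ.≤∧≢⇒< (subst (ℕ._≤ toℕ l) (sym j≡1+i) i<l) (¬ij ∘ (refl ,_) ∘ sym ∘ toℕ-injective)

  from-j : ∀ l → j Fin.< l → ¬ (j ≡ i × l ≡ j) → transpose i j j Fin.< transpose i j l
  from-j l j<l _ rewrite transposeʳ i j
                       | transpose-fix (ℕ.<⇒≢ (ℕ.<-trans i<j j<l) ∘ cong toℕ ∘ sym)
                                       (ℕ.<⇒≢ j<l ∘ cong toℕ ∘ sym) =
    ℕ.<-trans i<j j<l

  from-other : ∀ k → k ≢ i → k ≢ j →
               ∀ l → k Fin.< l → ¬ (k ≡ i × l ≡ j) → transpose i j k Fin.< transpose i j l
  from-other k k≢i k≢j rewrite transpose-fix k≢i k≢j = transpose-cases i j _
    (λ k<i _ → subst (k Fin.<_) (sym (transposeˡ i j)) (ℕ.<-trans k<i i<j))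
    (λ k<j _ → subst (k Fin.<_) (sym (transposeʳ i j))
                 (ℕ.≤∧≢⇒< (ℕ.≤-pred (subst (toℕ k ℕ.<_) j≡1+i k<j)) (k≢i ∘ toℕ-injective)))
    (λ l l≢i l≢j k<l _ → subst (k Fin.<_) (sym (transpose-fix l≢i l≢j)) k<l)

injective⇒surjective : ∀ (f : Fin m → Fin m) → Injective _≡_ _≡_ f → ∀ y → ∃[ x ] f x ≡ y
injective⇒surjective {suc m} f f-inj y with any? (λ x → f x Fin.≟ y)
... | yes hit = hit
... | no miss = ⊥-elim (ℕ.1+n≰n (injective⇒≤ (f-inj ∘ punchOut-injective (y≢f _) (y≢f _))))
  where
  y≢f : ∀ x → y ≢ f x
  y≢f x y≡fx = miss (x , sym y≡fx)

count : ∀ {n} {Q : Pred (Fin n) 0ℓ} → U.Decidable Q → ℕ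
count {zero}  Q? = 0
count {suc n} Q? with Q? Fin.zero
... | yes _ = suc (count (Q? ∘ Fin.suc))
... | no _  = count (Q? ∘ Fin.suc)

count-⊆-≤ : ∀ {n} {Q R : Pred (Fin n) 0ℓ} (Q? : U.Decidable Q) (R? : U.Decidable R) →
            Q ⊆ R → count Q? ℕ.≤ count R?
count-⊆-≤ {zero}  Q? R? Q⊆R = ℕ.z≤n
count-⊆-≤ {suc n} Q? R? Q⊆R with Q? Fin.zero | R? Fin.zero
... | yes q | no ¬r = ⊥-elim (¬r (Q⊆R q))
... | yes _ | yes _ = ℕ.s≤s (count-⊆-≤ (Q? ∘ Fin.suc) (R? ∘ Fin.suc) Q⊆R)
... | no _  | yes _ = ℕ.m≤n⇒m≤1+n (count-⊆-≤ (Q? ∘ Fin.suc) (R? ∘ Fin.suc) Q⊆R)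
... | no _  | no _  = count-⊆-≤ (Q? ∘ Fin.suc) (R? ∘ Fin.suc) Q⊆R

count-⊆-< : ∀ {n} {Q R : Pred (Fin n) 0ℓ} (Q? : U.Decidable Q) (R? : U.Decidable R) →
            Q ⊆ R → ∀ z → R z → ¬ Q z → count Q? ℕ.< count R?
count-⊆-< {suc n} Q? R? Q⊆R z rz ¬qz with Q? Fin.zero | R? Fin.zero
... | yes q | no ¬r = ⊥-elim (¬r (Q⊆R q))
count-⊆-< Q? R? Q⊆R Fin.zero    rz ¬qz | yes q | yes _ = ⊥-elim (¬qz q)
count-⊆-< Q? R? Q⊆R Fin.zero    rz ¬qz | no _  | yes _ =
  ℕ.s≤s (count-⊆-≤ (Q? ∘ Fin.suc) (R? ∘ Fin.suc) Q⊆R)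
count-⊆-< Q? R? Q⊆R Fin.zero    rz ¬qz | no _  | no ¬r = ⊥-elim (¬r rz)
count-⊆-< Q? R? Q⊆R (Fin.suc z) rz ¬qz | yes _ | yes _ =
  ℕ.s≤s (count-⊆-< (Q? ∘ Fin.suc) (R? ∘ Fin.suc) Q⊆R z rz ¬qz)
count-⊆-< Q? R? Q⊆R (Fin.suc z) rz ¬qz | no _  | yes _ =
  ℕ.m≤n⇒m≤1+n (count-⊆-< (Q? ∘ Fin.suc) (R? ∘ Fin.suc) Q⊆R z rz ¬qz)
count-⊆-< Q? R? Q⊆R (Fin.suc z) rz ¬qz | no _  | no _  =
  count-⊆-< (Q? ∘ Fin.suc) (R? ∘ Fin.suc) Q⊆R z rz ¬qz

count<n : ∀ {n} {Q : Pred (Fin n) 0ℓ} (Q? : U.Decidable Q) → ∀ z → ¬ Q z → count Q? ℕ.< n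
count<n {n} Q? z ¬qz = subst (count Q? ℕ.<_) (count-all n) (count-⊆-< Q? (λ _ → yes tt) _ z tt ¬qz)
  where
  count-all : ∀ n → count {n} (λ _ → yes tt) ≡ n
  count-all zero = refl
  count-all (suc n) = cong suc (count-all n)

flip-cong : ∀ {π ρ : Permutation′ m} → π ≈ ρ → flip π ≈ flip ρ
flip-cong {π = π} {ρ} π≈ρ x = begin
  π ⟨$⟩ˡ x                   ≡⟨ cong (π ⟨$⟩ˡ_) (inverseʳ ρ) ⟨
  π ⟨$⟩ˡ (ρ ⟨$⟩ʳ (ρ ⟨$⟩ˡ x)) ≡⟨ cong (π ⟨$⟩ˡ_) (π≈ρ _) ⟨
  π ⟨$⟩ˡ (π ⟨$⟩ʳ (ρ ⟨$⟩ˡ x)) ≡⟨ inverseˡ π ⟩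
  ρ ⟨$⟩ˡ x                   ∎

permutation-2-transitive : ∀ {u v p q : Fin m} → u ≢ v → p ≢ q →
                           Σ[ σ ∈ Permutation′ m ] σ ⟨$⟩ʳ u ≡ p × σ ⟨$⟩ʳ v ≡ q
permutation-2-transitive {u = u} {v} {p} {q} u≢v p≢q =
  Perm.transpose u p ∘ₚ Perm.transpose v′ q , σu≡p , transposeˡ v′ q
  where
  v′ = transpose u p v
  p≢v′ : p ≢ v′
  p≢v′ = u≢v ∘ transpose-injective u p ∘ trans (transposeˡ u p)
  σu≡p : transpose v′ q (transpose u p u) ≡ p
  σu≡p = begin
    transpose v′ q (transpose u p u) ≡⟨ cong (transpose v′ q) (transposeˡ u p) ⟩
    transpose v′ q p                 ≡⟨ transpose-fix p≢v′ p≢q ⟩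
    p                                ∎


module BenderKnuth {n : ℕ} (P : FinPoset n) where
  open FinPoset P
  open IsStrictPartialOrder isSPO using () renaming (trans to <P-trans; irrefl to <P-irrefl)

  lo hi : Gen P → Fin n
  lo (i , i+1<n) = fromℕ< (ℕ.≤-trans (ℕ.n≤1+n (suc i)) i+1<n)
  hi (i , i+1<n) = fromℕ< i+1<n

  toℕ-lo : ∀ g → toℕ (lo g) ≡ proj₁ g
  toℕ-lo (_ , _) = toℕ-fromℕ< _

  toℕ-hi : ∀ g → toℕ (hi g) ≡ suc (proj₁ g)
  toℕ-hi (_ , i+1<n) = toℕ-fromℕ< i+1<n

  hi≡1+lo : ∀ g → toℕ (hi g) ≡ suc (toℕ (lo g))
  hi≡1+lo g = trans (toℕ-hi g) (cong suc (sym (toℕ-lo g)))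

  swapPos≗transpose : ∀ g a → swapPos P g a ≡ transpose (lo g) (hi g) a
  swapPos≗transpose g@(i , _) a with toℕ a ℕ.≟ i | toℕ a ℕ.≟ suc i
  ... | yes a≡i | _
    rewrite toℕ-injective {i = a} {lo g} (trans a≡i (sym (toℕ-lo g))) = sym (transposeˡ (lo g) (hi g))
  ... | no _ | yes a≡1+i
    rewrite toℕ-injective {i = a} {hi g} (trans a≡1+i (sym (toℕ-hi g))) = sym (transposeʳ (lo g) (hi g))
  ... | no a≢i | no a≢1+i =
    sym (transpose-fix (a≢i ∘ λ a≡lo → trans (cong toℕ a≡lo) (toℕ-lo g))
                       (a≢1+i ∘ λ a≡hi → trans (cong toℕ a≡hi) (toℕ-hi g)))

  bkPerm : Word P → Permutation′ n
  bkPerm []      = Perm.id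
  bkPerm (g ∷ w) = bkPerm w ∘ₚ Perm.transpose (lo g) (hi g)

  bkPerm-++ : ∀ w w′ x → bkPerm (w ++ w′) ⟨$⟩ʳ x ≡ bkPerm w ⟨$⟩ʳ (bkPerm w′ ⟨$⟩ʳ x)
  bkPerm-++ []      w′ x = refl
  bkPerm-++ (g ∷ w) w′ x = cong (transpose (lo g) (hi g)) (bkPerm-++ w w′ x)

  swapPos-transpose : ∀ g a → swapPos P g (transpose (lo g) (hi g) a) ≡ a
  swapPos-transpose g a =
    trans (swapPos≗transpose g (transpose (lo g) (hi g) a)) (transpose-involutive (lo g) (hi g) a)

  transpose-swapPos : ∀ g a → transpose (lo g) (hi g) (swapPos P g a) ≡ a
  transpose-swapPos g a =
    trans (cong (transpose (lo g) (hi g)) (swapPos≗transpose g a)) (transpose-involutive (lo g) (hi g) a)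

  record IsLinExt (s : Fin n → Fin n) : Set where
    field
      covers   : ∀ x → ∃[ a ] s a ≡ x
      distinct : ∀ a b → s a ≡ s b → a ≡ b
      order    : ∀ a b → s a <P s b → a Fin.< b

  linExt : ∀ {s} → IsLinExt s → LinExt P
  linExt {s} s-le = record { seq = s ; IsLinExt s-le }

  isLinExt : ∀ (L : LinExt P) → IsLinExt (LinExt.seq L)
  isLinExt L = record { LinExt L }

  swap-isLinExt : ∀ g {s} → IsLinExt s → ¬ s (lo g) <P s (hi g) → IsLinExt (s ∘ swapPos P g)
  swap-isLinExt g {s} s-le ¬lo<hi = record
    { covers   = λ x → let (a , sa≡x) = covers x in
                       τ a , trans (cong s (swapPos-transpose g a)) sa≡x
    ; distinct = λ a b e → trans (sym (transpose-swapPos g a))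
                             (trans (cong τ (distinct _ _ e)) (transpose-swapPos g b))
    ; order    = λ a b r → subst₂ Fin._<_ (transpose-swapPos g a) (transpose-swapPos g b)
                             (transpose-adjacent-< (hi≡1+lo g) _ _ (order _ _ r)
                               (λ (e₁ , e₂) → ¬lo<hi (subst₂ (λ u v → s u <P s v) e₁ e₂ r)))
    }
    where
    open IsLinExt s-le
    τ = transpose (lo g) (hi g)

  bk-isLinExt : ∀ g {s} → IsLinExt s → IsLinExt (bk P g s)
  bk-isLinExt g {s} s-le with s (lo g) <P? s (hi g) | s (hi g) <P? s (lo g)
  ... | yes _ | _          = s-le
  ... | no _  | yes _      = s-le
  ... | no ¬lo<hi | no _ = swap-isLinExt g s-le ¬lo<hi

  act-isLinExt : ∀ w {s} → IsLinExt s → IsLinExt (act P w s)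
  act-isLinExt []      s-le = s-le
  act-isLinExt (g ∷ w) s-le = bk-isLinExt g (act-isLinExt w s-le)

  linExt-fromRank : (r : Fin n → Fin n) → Injective _≡_ _≡_ r →
                    (∀ {x y} → x <P y → r x Fin.< r y) → LinExt P
  linExt-fromRank r r-inj r-mono = record
    { seq      = seq
    ; covers   = λ x → r x , r-inj (r∘seq (r x))
    ; distinct = λ a b e → trans (sym (r∘seq a)) (trans (cong r e) (r∘seq b))
    ; order    = λ a b sa<sb → subst₂ Fin._<_ (r∘seq a) (r∘seq b) (r-mono sa<sb)
    }
    where
    seq : Fin n → Fin n
    seq a = proj₁ (injective⇒surjective r r-inj a)
    r∘seq : ∀ a → r (seq a) ≡ a
    r∘seq a = proj₂ (injective⇒surjective r r-inj a)

  height : Fin n → ℕ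
  height x = count (_<P? x)

  height-mono : ∀ {x y} → x <P y → height x ℕ.< height y
  height-mono {x} {y} x<y = count-⊆-< (_<P? x) (_<P? y) (λ z<x → <P-trans z<x x<y) x x<y (<P-irrefl refl)

  _≺_ : Rel (Fin n) 0ℓ
  _≺_ = ×-Lex _≡_ ℕ._<_ Fin._<_ on (λ x → height x , x)

  ≺-connex : ∀ {x y} → x ≢ y → x ≺ y ⊎ y ≺ x
  ≺-connex {x} {y} x≢y with ℕ.<-cmp (height x) (height y) | FinP.<-cmp x y
  ... | tri< hx<hy _ _ | _ = inj₁ (inj₁ hx<hy)
  ... | tri> _ _ hy<hx | _ = inj₂ (inj₁ hy<hx)
  ... | tri≈ _ hx≡hy _ | tri< x<y _ _ = inj₁ (inj₂ (hx≡hy , x<y))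
  ... | tri≈ _ _ _     | tri≈ _ x≡y _ = ⊥-elim (x≢y x≡y)
  ... | tri≈ _ hx≡hy _ | tri> _ _ y<x = inj₂ (inj₂ (sym hx≡hy , y<x))

  _≺?_ : Decidable _≺_
  x ≺? y = ×-decidable ℕ._≟_ ℕ._<?_ FinP._<?_ (height x , x) (height y , y)

  ≺-trans : Transitive _≺_
  ≺-trans = ×-transitive {_<₂_ = Fin._<_} isEquivalence ℕ.<-resp₂-≡ ℕ.<-trans FinP.<-trans

  ≺-irrefl : ∀ {x} → ¬ x ≺ x
  ≺-irrefl (inj₁ hx<hx)    = ℕ.<-irrefl refl hx<hx
  ≺-irrefl (inj₂ (_ , x<x)) = FinP.<-irrefl refl x<x

  rank : Fin n → Fin n
  rank x = fromℕ< (count<n (_≺? x) x ≺-irrefl)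

  rank-mono : ∀ {x y} → x ≺ y → rank x Fin.< rank y
  rank-mono {x} {y} x≺y = subst₂ ℕ._<_ (sym (toℕ-fromℕ< _)) (sym (toℕ-fromℕ< _))
    (count-⊆-< (_≺? x) (_≺? y) (λ z≺x → ≺-trans z≺x x≺y) x x≺y ≺-irrefl)

  rank-injective : Injective _≡_ _≡_ rank
  rank-injective {x} {y} rx≡ry with x Fin.≟ y
  ... | yes x≡y = x≡y
  ... | no x≢y with ≺-connex x≢y
  ...   | inj₁ x≺y = ⊥-elim (FinP.<-irrefl rx≡ry (rank-mono x≺y))
  ...   | inj₂ y≺x = ⊥-elim (FinP.<-irrefl (sym rx≡ry) (rank-mono y≺x))

  someLinExt : LinExt P
  someLinExt = linExt-fromRank rank rank-injective (rank-mono ∘ inj₁ ∘ height-mono)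

  record Realizable (σ : Permutation′ n) : Set where
    constructor realizedBy
    field
      word     : Word P
      realizes : bkPerm word ≈ σ

  realizable-resp : ∀ {σ ρ} → σ ≈ ρ → Realizable σ → Realizable ρ
  realizable-resp σ≈ρ (realizedBy w w≈σ) = realizedBy w λ x → trans (w≈σ x) (σ≈ρ x)

  realizable-∘ : ∀ {σ ρ} → Realizable σ → Realizable ρ → Realizable (σ ∘ₚ ρ)
  realizable-∘ {σ} {ρ} (realizedBy w w≈σ) (realizedBy v v≈ρ) = realizedBy (v ++ w) λ x →
    trans (bkPerm-++ v w x) (trans (v≈ρ _) (cong (ρ ⟨$⟩ʳ_) (w≈σ x)))

  realizable-adjacent : ∀ {i j : Fin n} → toℕ j ≡ suc (toℕ i) → Realizable (Perm.transpose i j)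
  realizable-adjacent {i} {j} j≡1+i = realizedBy (g ∷ []) λ x → cong₂ (λ u v → transpose u v x) lo≡i hi≡j
    where
    g : Gen P
    g = toℕ i , subst (ℕ._< n) j≡1+i (FinP.toℕ<n j)
    lo≡i : lo g ≡ i
    lo≡i = toℕ-injective (toℕ-lo g)
    hi≡j : hi g ≡ j
    hi≡j = toℕ-injective (trans (toℕ-hi g) (sym j≡1+i))

  -- (i j) is the conjugate of (i j-1) by the adjacent transposition (j-1 j).
  realizable-transpose-< : ∀ d {i j : Fin n} → toℕ j ≡ toℕ i ℕ.+ suc d → Realizable (Perm.transpose i j)
  realizable-transpose-< zero    {i} j≡i+1 = realizable-adjacent (trans j≡i+1 (ℕ.+-comm (toℕ i) 1))
  realizable-transpose-< (suc d) {i} {j} j≡i+d+2 =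
    realizable-resp conjugate
      (realizable-∘ τ-realizable (realizable-∘ (realizable-transpose-< d a≡i+d+1) τ-realizable))
    where
    j≡1+i+d+1 : toℕ j ≡ suc (toℕ i ℕ.+ suc d)
    j≡1+i+d+1 = trans j≡i+d+2 (ℕ.+-suc (toℕ i) (suc d))
    a : Fin n
    a = fromℕ< (ℕ.<-trans (ℕ.n<1+n _) (subst (ℕ._< n) j≡1+i+d+1 (FinP.toℕ<n j)))
    a≡i+d+1 : toℕ a ≡ toℕ i ℕ.+ suc d
    a≡i+d+1 = toℕ-fromℕ< _
    τ = transpose a j
    τₚ = Perm.transpose a j
    τ-realizable : Realizable τₚ
    τ-realizable = realizable-adjacent (trans j≡1+i+d+1 (cong suc (sym a≡i+d+1)))
    i≢a : i ≢ a
    i≢a i≡a = ℕ.m+1+n≢m (toℕ i) (sym (trans (cong toℕ i≡a) a≡i+d+1))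
    i≢j : i ≢ j
    i≢j i≡j = ℕ.m+1+n≢m (toℕ i) (sym (trans (cong toℕ i≡j) j≡i+d+2))
    τi≡i : τ i ≡ i
    τi≡i = transpose-fix i≢a i≢j
    conjugate : τₚ ∘ₚ Perm.transpose i a ∘ₚ τₚ ≈ Perm.transpose i j
    conjugate x = begin
      τ (transpose i a (τ x))         ≡⟨ transpose-conjugate τ (transpose-injective a j) i a (τ x) ⟩
      transpose (τ i) (τ a) (τ (τ x)) ≡⟨ cong₂ (λ u v → transpose u v (τ (τ x))) τi≡i (transposeˡ a j) ⟩
      transpose i j (τ (τ x))         ≡⟨ cong (transpose i j) (transpose-involutive a j x) ⟩
      transpose i j x                 ∎

  realizable-transpose : ∀ (i j : Fin n) → Realizable (Perm.transpose i j)
  realizable-transpose i j with ℕ.<-cmp (toℕ i) (toℕ j)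
  ... | tri< i<j _ _ = let (d , i+d≡j) = ℕ.m≤n⇒∃[o]m+o≡n i<j in
                       realizable-transpose-< d (sym (trans (ℕ.+-suc (toℕ i) d) i+d≡j))
  ... | tri> _ _ j<i = let (d , j+d≡i) = ℕ.m≤n⇒∃[o]m+o≡n j<i in
                       realizable-resp (transpose-comm j i)
                         (realizable-transpose-< d (sym (trans (ℕ.+-suc (toℕ j) d) j+d≡i)))
  ... | tri≈ _ i≡j _ rewrite toℕ-injective i≡j = realizedBy [] λ x → sym (transpose-self j x)

  realizable-eval : ∀ (xs : TranspositionList n) → Realizable (eval xs)
  realizable-eval []             = realizedBy [] λ _ → refl
  realizable-eval ((i , j) ∷ xs) = realizable-∘ (realizable-transpose i j) (realizable-eval xs)

  realizable : ∀ (σ : Permutation′ n) → Realizable σ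
  realizable σ = realizable-resp (eval-decompose σ) (realizable-eval (decompose σ))

module DisjointUnionOfChains {n : ℕ} (P : FinPoset n) (D : IsDisjointUnionOfChains P) where
  open FinPoset P
  open IsDisjointUnionOfChains D
  open BenderKnuth P

  comparable⇒sameBlock : ∀ {x y} → x <P y ⊎ y <P x → block x ≡ block y
  comparable⇒sameBlock x∼y = proj₁ (Equivalence.to (comparable _ _) x∼y)

  swapPos-sameBlock : ∀ g s → s (lo g) <P s (hi g) ⊎ s (hi g) <P s (lo g) →
                      ∀ a → block (s (swapPos P g a)) ≡ block (s a)
  swapPos-sameBlock g s lo∼hi a =
    trans (cong (block ∘ s) (swapPos≗transpose g a))
          (transpose-invariant (block ∘ s) (comparable⇒sameBlock lo∼hi) a)

  bk-block : ∀ g s a → block (bk P g s a) ≡ block (s (swapPos P g a))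
  bk-block g s a with s (lo g) <P? s (hi g) | s (hi g) <P? s (lo g)
  ... | yes lo<hi | _         = sym (swapPos-sameBlock g s (inj₁ lo<hi) a)
  ... | no _      | yes hi<lo = sym (swapPos-sameBlock g s (inj₂ hi<lo) a)
  ... | no _      | no _      = refl

  act-block : ∀ w s a → block (act P w s (bkPerm w ⟨$⟩ʳ a)) ≡ block (s a)
  act-block []      s a = refl
  act-block (g ∷ w) s a = begin
    block (bk P g (act P w s) (τ (bkPerm w ⟨$⟩ʳ a)))         ≡⟨ bk-block g (act P w s) _ ⟩
    block (act P w s (swapPos P g (τ (bkPerm w ⟨$⟩ʳ a)))) ≡⟨ cong (block ∘ act P w s) (swapPos-transpose g _) ⟩
    block (act P w s (bkPerm w ⟨$⟩ʳ a))                    ≡⟨ act-block w s a ⟩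
    block (s a)                                           ∎
    where τ = transpose (lo g) (hi g)

  -- The occurrence of s a in t would lie before a, where t agrees with s.
  agree-before⇒¬< : ∀ {s t} → IsLinExt s → IsLinExt t →
                    ∀ a → (∀ {b} → b Fin.< a → s b ≡ t b) → ¬ s a <P t a
  agree-before⇒¬< s-le t-le a agree sa<ta =
    FinP.<-irrefl (IsLinExt.distinct s-le b a (trans (agree b<a) tb≡sa)) b<a
    where
    b = proj₁ (IsLinExt.covers t-le _)
    tb≡sa = proj₂ (IsLinExt.covers t-le _)
    b<a : b Fin.< a
    b<a = IsLinExt.order t-le b a (subst (_<P _) (sym tb≡sa) sa<ta)

  linExt-unique : ∀ {s t} → IsLinExt s → IsLinExt t →
                  (∀ a → block (s a) ≡ block (t a)) → ∀ a → s a ≡ t a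
  linExt-unique {s} {t} s-le t-le same = All.wfRec FinI.<-wellFounded 0ℓ (λ a → s a ≡ t a) step
    where
    step : ∀ a → (∀ {b} → b Fin.< a → s b ≡ t b) → s a ≡ t a
    step a agree with s a Fin.≟ t a
    ... | yes sa≡ta = sa≡ta
    ... | no sa≢ta with Equivalence.from (comparable (s a) (t a)) (same a , sa≢ta)
    ...   | inj₁ sa<ta = ⊥-elim (agree-before⇒¬< s-le t-le a agree sa<ta)
    ...   | inj₂ ta<sa = ⊥-elim (agree-before⇒¬< t-le s-le a (sym ∘ agree) ta<sa)

  act-block-inverse : ∀ w s a → block (act P w s a) ≡ block (s (bkPerm w ⟨$⟩ˡ a))
  act-block-inverse w s a =
    trans (cong (block ∘ act P w s) (sym (inverseʳ (bkPerm w)))) (act-block w s (bkPerm w ⟨$⟩ˡ a))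

  distinctBlocks : ∀ {k} → 2 ℕ.≤ k → Σ[ b ∈ Fin k ] Σ[ c ∈ Fin k ] b ≢ c
  distinctBlocks (ℕ.s≤s (ℕ.s≤s _)) = Fin.zero , Fin.suc Fin.zero , λ ()

  positionOfBlock : ∀ (L : LinExt P) b → Σ[ u ∈ Fin n ] block (LinExt.seq L u) ≡ b
  positionOfBlock L b = let (x , bx≡b) = nonempty b ; (u , Lu≡x) = LinExt.covers L x in
                        u , trans (cong block Lu≡x) bx≡b

  moveTwo : ∀ {u v p q} → u ≢ v → p ≢ q →
            ∃[ w ] ∀ s → block (act P w s p) ≡ block (s u) × block (act P w s q) ≡ block (s v)
  moveTwo u≢v p≢q with permutation-2-transitive u≢v p≢q
  ... | σ , σu≡p , σv≡q = w , λ s → moved s σu≡p , moved s σv≡q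
    where
    open Realizable (realizable σ) renaming (word to w)
    moved : ∀ s {x y} → σ ⟨$⟩ʳ x ≡ y → block (act P w s y) ≡ block (s x)
    moved s {x} σx≡y =
      trans (cong (block ∘ act P w s) (trans (sym σx≡y) (sym (realizes x)))) (act-block w s x)

  separation : ∀ {p q} → p ≢ q →
               Σ[ L ∈ LinExt P ] block (LinExt.seq L p) ≢ block (LinExt.seq L q)
  separation p≢q =
    let s₀            = LinExt.seq someLinExt
        (b , c , b≢c) = distinctBlocks two≤k
        (u , s₀u≡b)   = positionOfBlock someLinExt b
        (v , s₀v≡c)   = positionOfBlock someLinExt c
        u≢v : u ≢ v
        u≢v u≡v       = b≢c (trans (sym s₀u≡b) (trans (cong (block ∘ s₀) u≡v) s₀v≡c))
        (w , moved)   = moveTwo u≢v p≢q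
        (p↦u , q↦v)   = moved s₀
    in linExt (act-isLinExt w (isLinExt someLinExt)) ,
       λ same → b≢c (trans (sym s₀u≡b) (trans (sym p↦u) (trans same (trans q↦v s₀v≡c))))

  ≈BK⇔≈ : ∀ w w′ → (_≈BK_ P w w′) ⇔ (bkPerm w ≈ bkPerm w′)
  ≈BK⇔≈ w w′ = mk⇔ to from
    where
    sameInverse⇒sameBlocks : flip (bkPerm w) ≈ flip (bkPerm w′) →
                             ∀ s a → block (act P w s a) ≡ block (act P w′ s a)
    sameInverse⇒sameBlocks w⁻¹≈w′⁻¹ s a =
      trans (act-block-inverse w s a)
            (trans (cong (block ∘ s) (w⁻¹≈w′⁻¹ a)) (sym (act-block-inverse w′ s a)))

    from : bkPerm w ≈ bkPerm w′ → _≈BK_ P w w′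
    from w≈w′ L = linExt-unique (act-isLinExt w (isLinExt L)) (act-isLinExt w′ (isLinExt L))
                    (sameInverse⇒sameBlocks (flip-cong {π = bkPerm w} {bkPerm w′} w≈w′) (LinExt.seq L))

    to : _≈BK_ P w w′ → bkPerm w ≈ bkPerm w′
    to w≈BKw′ = flip-cong {π = flip (bkPerm w)} {flip (bkPerm w′)} sameInverse
      where
      sameInverse : flip (bkPerm w) ≈ flip (bkPerm w′)
      sameInverse a with bkPerm w ⟨$⟩ˡ a Fin.≟ bkPerm w′ ⟨$⟩ˡ a
      ... | yes same = same
      ... | no differ =
        let (L , blocksDiffer) = separation differ ; s = LinExt.seq L in
        ⊥-elim (blocksDiffer (trans (sym (act-block-inverse w s a))
                               (trans (cong block (w≈BKw′ L a)) (act-block-inverse w′ s a))))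

lemma4p7 : (n : ℕ) (P : FinPoset n) → IsDisjointUnionOfChains P → BK≅Sym P
lemma4p7 n P D = bkPerm , ≈BK⇔≈ , bkPerm-++ , λ σ → word (realizable σ) , realizes (realizable σ)
  where
  open BenderKnuth P
  open DisjointUnionOfChains P D
  open Realizable
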